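{- Let $b\geq 2$ and $N\geq 1$ be integers. Suppose that $m\geq 1$ and $k\geq 1$ are integers and that $F_{m+k}=b^t F_m + r$ for some integers $t$ and $r$ with $1\leq t\leq N$ and $0\leq r < b^t$. Then \[ F_{k+1} < 2\,b^N, \] and hence \[ k \leq 1 + \log_\varphi(2b^N) = N\log_\varphi b + \log_\varphi 2 + 1. \]
   Context: $(F_n)_{n\geq 0}$ denotes the Fibonacci sequence: $F_0=0$, $F_1=1$, $F_{n+1}=F_n+F_{n-1}$. $\varphi=\frac{1+\sqrt5}{2}$. -}

module Defs where

open import Data.Nat using (ℕ; zero; suc; _+_; _*_; _∸_; _^_; _≤_)
open import Data.Product using (_×_)

fib : ℕ → ℕ
fib zero = 0
fib (suc zero) = 1
fib (suc (suc n)) = fib (suc n) + fib n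

lucas : ℕ → ℕ
lucas zero = 2
lucas (suc zero) = 1
lucas (suc (suc n)) = lucas (suc n) + lucas n

-- φ ^ n ≤ x  for a natural number x, stated exactly without real numbers.
-- Uses φ ^ n = (L n + F n √5) / 2, so φ ^ n ≤ x  iff  F n √5 ≤ 2x - L n,
-- iff  L n ≤ 2x  and  5 (F n)² ≤ (2x - L n)².
PhiPow≤ : ℕ → ℕ → Set
PhiPow≤ n x = (lucas n ≤ 2 * x) × (5 * (fib n * fib n) ≤ (2 * x ∸ lucas n) * (2 * x ∸ lucas n))

{-# OPTIONS --safe #-}
module Submission where

open import Defs
open import Data.Nat using (ℕ; zero; suc; _+_; _*_; _∸_; _^_; _≤_; _<_; z≤n; s≤s)
open import Data.Nat.Properties
open import Algebra.Properties.CommutativeSemigroup +-commutativeSemigroup using (interchange)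
open import Data.Nat.Tactic.RingSolver using (solve-∀)
open import Data.Product using (_×_; _,_)
open import Relation.Binary.PropositionalEquality

-- By the addition formula F(m+k) = F(k+1) F(m) + F(k) F(m-1) ≥ F(k+1) F(m), while
-- b^t F(m) + r < b^t F(m) + b^t ≤ 2 b^t F(m) ≤ 2 b^N F(m); cancelling F(m) gives
-- F(k+1) < 2 b^N. The claim about φ then follows from φ^(k-1) ≤ F(k+1), which in the
-- encoding PhiPow≤ amounts to 2 F(n+2) − L(n) = 3 F(n) together with 5 ≤ 3².

q*n+r<2*q*n : ∀ {q n r} → 1 ≤ n → r < q → q * n + r < 2 * q * n
q*n+r<2*q*n {q} {n@(suc _)} {r} (s≤s z≤n) r<q = begin-strict
  q * n + r      <⟨ +-monoʳ-< (q * n) r<q ⟩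
  q * n + q      ≤⟨ +-monoʳ-≤ (q * n) (m≤m*n q n) ⟩
  q * n + q * n  ≡⟨ cong (q * n +_) (sym (+-identityʳ (q * n))) ⟩
  2 * (q * n)    ≡⟨ sym (*-assoc 2 q n) ⟩
  2 * q * n      ∎
  where open ≤-Reasoning

1≤fib[1+n] : ∀ n → 1 ≤ fib (suc n)
1≤fib[1+n] zero    = ≤-refl
1≤fib[1+n] (suc n) = ≤-trans (1≤fib[1+n] n) (m≤m+n _ _)

fib[1+m+n] : ∀ m n → fib (suc m + n) ≡ fib (suc m) * fib (suc n) + fib m * fib n
fib[1+m+n] zero          n = identity (fib (suc n)) (fib n)
  where
  identity : ∀ x y → x ≡ 1 * x + 0 * y
  identity = solve-∀
fib[1+m+n] (suc zero)    n = identity (fib (suc n)) (fib n)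
  where
  identity : ∀ x y → x + y ≡ 1 * x + 1 * y
  identity = solve-∀
fib[1+m+n] (suc (suc m)) n = begin
  fib (suc (suc m) + n) + fib (suc m + n)
    ≡⟨ cong₂ _+_ (fib[1+m+n] (suc m) n) (fib[1+m+n] m n) ⟩
  (fib (2 + m) * fib (suc n) + fib (suc m) * fib n) + (fib (suc m) * fib (suc n) + fib m * fib n)
    ≡⟨ regroup (fib (2 + m)) (fib (suc m)) (fib m) (fib (suc n)) (fib n) ⟩
  (fib (2 + m) + fib (suc m)) * fib (suc n) + (fib (suc m) + fib m) * fib n
    ∎
  where
  open ≡-Reasoning
  regroup : ∀ a b c x y → (a * x + b * y) + (b * x + c * y) ≡ (a + b) * x + (b + c) * y
  regroup = solve-∀

fib[1+k]*fib[m]≤fib[m+k] : ∀ m k → fib (suc k) * fib m ≤ fib (m + k)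
fib[1+k]*fib[m]≤fib[m+k] zero    k = subst (_≤ fib k) (sym (*-zeroʳ (fib (suc k)))) z≤n
fib[1+k]*fib[m]≤fib[m+k] (suc m) k = begin
  fib (suc k) * fib (suc m)                       ≡⟨ *-comm (fib (suc k)) (fib (suc m)) ⟩
  fib (suc m) * fib (suc k)                       ≤⟨ m≤m+n _ _ ⟩
  fib (suc m) * fib (suc k) + fib m * fib k       ≡⟨ fib[1+m+n] m k ⟨
  fib (suc m + k)                                 ∎
  where open ≤-Reasoning

fib[m+k]≡q*fib[m]+r⇒fib[1+k]<2*q : ∀ {m k q r} → 1 ≤ m → r < q →
  fib (m + k) ≡ q * fib m + r → fib (suc k) < 2 * q
fib[m+k]≡q*fib[m]+r⇒fib[1+k]<2*q {suc m} {k} {q} {r} (s≤s z≤n) r<q eq =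
  *-cancelʳ-< (fib (suc m)) _ _ (begin-strict
    fib (suc k) * fib (suc m)  ≤⟨ fib[1+k]*fib[m]≤fib[m+k] (suc m) k ⟩
    fib (suc m + k)            ≡⟨ eq ⟩
    q * fib (suc m) + r        <⟨ q*n+r<2*q*n (1≤fib[1+n] m) r<q ⟩
    2 * q * fib (suc m)        ∎)
  where open ≤-Reasoning

lucas+fib≡2*fib[1+n] : ∀ n → lucas n + fib n ≡ 2 * fib (suc n)
lucas+fib≡2*fib[1+n] zero          = refl
lucas+fib≡2*fib[1+n] (suc zero)    = refl
lucas+fib≡2*fib[1+n] (suc (suc n)) = begin
  (lucas (suc n) + lucas n) + (fib (suc n) + fib n)
    ≡⟨ interchange (lucas (suc n)) (lucas n) (fib (suc n)) (fib n) ⟩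
  (lucas (suc n) + fib (suc n)) + (lucas n + fib n)
    ≡⟨ cong₂ _+_ (lucas+fib≡2*fib[1+n] (suc n)) (lucas+fib≡2*fib[1+n] n) ⟩
  2 * fib (2 + n) + 2 * fib (suc n)
    ≡⟨ *-distribˡ-+ 2 (fib (2 + n)) (fib (suc n)) ⟨
  2 * (fib (2 + n) + fib (suc n))
    ∎
  where open ≡-Reasoning

PhiPow≤-mono : ∀ {n x y} → x ≤ y → PhiPow≤ n x → PhiPow≤ n y
PhiPow≤-mono {n} {x} {y} x≤y (L≤2x , 5F²≤[2x∸L]²) =
  ≤-trans L≤2x 2x≤2y , ≤-trans 5F²≤[2x∸L]² (*-mono-≤ 2x∸L≤2y∸L 2x∸L≤2y∸L)
  where
  2x≤2y : 2 * x ≤ 2 * y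
  2x≤2y = *-monoʳ-≤ 2 x≤y
  2x∸L≤2y∸L : 2 * x ∸ lucas n ≤ 2 * y ∸ lucas n
  2x∸L≤2y∸L = ∸-monoˡ-≤ (lucas n) 2x≤2y

PhiPow≤-intro : ∀ {n x} d → 2 * x ≡ lucas n + d → 5 * (fib n * fib n) ≤ d * d → PhiPow≤ n x
PhiPow≤-intro {n} {x} d 2x≡L+d 5F²≤d² = L≤2x , 5F²≤[2x∸L]²
  where
  2x∸L≡d : 2 * x ∸ lucas n ≡ d
  2x∸L≡d = trans (cong (_∸ lucas n) 2x≡L+d) (m+n∸m≡n (lucas n) d)
  L≤2x : lucas n ≤ 2 * x
  L≤2x = subst (lucas n ≤_) (sym 2x≡L+d) (m≤m+n (lucas n) d)
  5F²≤[2x∸L]² : 5 * (fib n * fib n) ≤ (2 * x ∸ lucas n) * (2 * x ∸ lucas n)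
  5F²≤[2x∸L]² = subst (λ e → 5 * (fib n * fib n) ≤ e * e) (sym 2x∸L≡d) 5F²≤d²

PhiPow≤-fib : ∀ n → PhiPow≤ n (fib (2 + n))
PhiPow≤-fib n = PhiPow≤-intro {n} {fib (2 + n)} (3 * fib n) 2*fib[2+n]≡L+3F 5F²≤[3F]²
  where
  2*fib[2+n]≡L+3F : 2 * fib (2 + n) ≡ lucas n + 3 * fib n
  2*fib[2+n]≡L+3F = begin
    2 * (fib (suc n) + fib n)        ≡⟨ *-distribˡ-+ 2 (fib (suc n)) (fib n) ⟩
    2 * fib (suc n) + 2 * fib n      ≡⟨ cong (_+ 2 * fib n) (lucas+fib≡2*fib[1+n] n) ⟨
    lucas n + fib n + 2 * fib n      ≡⟨ +-assoc (lucas n) (fib n) (2 * fib n) ⟩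
    lucas n + 3 * fib n              ∎
    where open ≡-Reasoning
  5F²≤[3F]² : 5 * (fib n * fib n) ≤ (3 * fib n) * (3 * fib n)
  5F²≤[3F]² = subst (5 * (fib n * fib n) ≤_) (5x²+4x²≡[3x]² (fib n)) (m≤m+n _ _)
    where
    5x²+4x²≡[3x]² : ∀ x → 5 * (x * x) + 4 * (x * x) ≡ (3 * x) * (3 * x)
    5x²+4x²≡[3x]² = solve-∀

lemma3p2 : (b N m k t r : ℕ) → 2 ≤ b → 1 ≤ N → 1 ≤ m → 1 ≤ k →
    1 ≤ t → t ≤ N → r < b ^ t →
    fib (m + k) ≡ b ^ t * fib m + r →
    (fib (k + 1) < 2 * b ^ N) × PhiPow≤ (k ∸ 1) (2 * b ^ N)
lemma3p2 b N m (suc j) t r (s≤s (s≤s _)) _ 1≤m _ _ t≤N r<bᵗ eq =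
  subst (λ i → fib i < 2 * b ^ N) (+-comm 1 (suc j)) fib[2+j]<2bᴺ ,
  PhiPow≤-mono {j} (<⇒≤ fib[2+j]<2bᴺ) (PhiPow≤-fib j)
  where
  fib[2+j]<2bᴺ : fib (2 + j) < 2 * b ^ N
  fib[2+j]<2bᴺ = <-≤-trans (fib[m+k]≡q*fib[m]+r⇒fib[1+k]<2*q 1≤m r<bᵗ eq)
                           (*-monoʳ-≤ 2 (^-monoʳ-≤ b t≤N))
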